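{- Let $I$ be any input sequence of length $n$ and let $D(I)=a_1',a_2',\ldots,a_n'$ be the list of the $n$ requests of $I$ sorted in nondecreasing order of their frequencies in $I$. Then, for odd $n$, $\mathrm{Maj}_W(I)=2\sum_{i=1}^{\lfloor n/2\rfloor} f_I(a_i')+f_I(a'_{\lceil n/2\rceil})$, and for even $n$, $\mathrm{Maj}_W(I)=2\sum_{i=1}^{n/2} f_I(a_i')$.
   Context: Online frequent items problem with a buffer of size one. An input sequence is $I=a_1,\ldots,a_n$ of items from an infinite universe; $n=|I|$. An algorithm maintains a buffer holding one item; $s_t$ is the buffer content after step $t$; at step $1$ the buffer receives $a_1$, and at each later step $t$ the algorithm either keeps $s_{t-1}$ or replaces it by $a_t$. The frequency of $a$ in $I$ is $f_I(a)=n_I(a)/n$ with $n_I(a)=|\{i:a_i=a\}|$. The aggregate frequency of algorithm $\mathcal A$ on $I$ is $\mathcal A(I)=\sum_{t=1}^n f_I(s_t^{\mathcal A})$. Maj keeps a counter, initially $0$: when an item arrives, if the counter is $0$ it buffers the item and sets the counter to $1$; otherwise, if the arriving item equals the buffered item the counter is incremented, else it is decremented (buffer unchanged). For an algorithm $\mathcal A$, $\mathcal A_W(I)=\min_\sigma \mathcal A(\sigma(I))$, the minimum over all permutations (reorderings) $\sigma(I)$ of $I$. Example of $D(I)$: if $I=a,b,c,a,b,a$ then $D(I)=c,b,b,a,a,a$. -}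

module Defs where

open import Data.Nat using (ℕ; zero; suc; _≟_)
open import Data.Integer using (+_)
open import Data.List using (List; []; _∷_; length; foldr; map)
open import Data.List.Relation.Binary.Permutation.Propositional using (_↭_)
open import Data.Product using (Σ; _×_)
open import Data.Rational using (ℚ; _/_; 0ℚ; _+_; _≤_)
open import Relation.Nullary using (yes; no)
open import Relation.Binary.PropositionalEquality using (_≡_)

count : ℕ → List ℕ → ℕ
count a [] = zero
count a (x ∷ xs) with a ≟ x
... | yes _ = suc (count a xs)
... | no  _ = count a xs

-- f_I(a) = n_I(a) / n  (for the empty sequence, which has no items, we set 0)
freq : List ℕ → ℕ → ℚ
freq [] a = 0ℚ
freq I@(x ∷ xs) a = (+ count a I) / length I

sumℚ : List ℚ → ℚ
sumℚ = foldr _+_ 0ℚ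

-- Maj: given current buffer b and counter c, the buffer contents s_t after
-- each step on the remaining input.
majRun : ℕ → ℕ → List ℕ → List ℕ
majRun b c [] = []
majRun b zero (x ∷ xs) = x ∷ majRun x 1 xs
majRun b (suc c) (x ∷ xs) with x ≟ b
... | yes _ = b ∷ majRun b (suc (suc c)) xs
... | no  _ = b ∷ majRun b c xs

-- buffer contents s_1, ..., s_n of Maj on I (initial counter 0,
-- so the initial buffer value is irrelevant)
majBuffers : List ℕ → List ℕ
majBuffers I = majRun 0 0 I

Maj : List ℕ → ℚ
Maj I = sumℚ (map (freq I) (majBuffers I))

IsMajW : List ℕ → ℚ → Set
IsMajW I v = ((J : List ℕ) → J ↭ I → v ≤ Maj J)
           × Σ (List ℕ) (λ J → J ↭ I × Maj J ≡ v)

data SortedByFreq (I : List ℕ) : List ℕ → Set where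
  []  : SortedByFreq I []
  [_] : ∀ x → SortedByFreq I (x ∷ [])
  _∷_ : ∀ {x y ys} → freq I x ≤ freq I y → SortedByFreq I (y ∷ ys)
        → SortedByFreq I (x ∷ y ∷ ys)

IsD : List ℕ → List ℕ → Set
IsD I D = (D ↭ I) × SortedByFreq I D

module Submission where

-- Fix a threshold θ and call a request heavy if its item occurs at least θ times in I.  In any
-- order, Maj buffers a heavy item in at least 2h − n of the n steps, where h is the number of heavy
-- requests, since a light request can cancel at most one heavy request.  Heavy requests form a
-- suffix of D(I) = L M R, so max (0, 2h − n) is the number of heavy requests in L, L and M.  A count
-- is the number of thresholds it reaches, so summing over θ gives the lower bound 2 Σ_L f + Σ_M f.
-- Interleaving L with the reverse of R attains it: Maj buffers the lighter item of each pair twice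
-- and ends the pair with counter 0 (unless all counts are equal, when every order is optimal).

open import Data.Nat using (ℕ; zero; suc; _*_; _≤_; _⊓_; _⊔_; z≤n; s≤s; _≤?_; _≟_)
open import Data.Nat.Properties
open import Data.Nat.ListAction using (sum)
open import Data.Nat.ListAction.Properties using (sum-++; sum-↭)
open import Data.List using (List; []; _∷_; _++_; _∷ʳ_; length; map; filter; initLast; _∷ʳ′_)
open import Data.List.Properties
  using (length-++; map-++; ++-assoc; ++-conicalˡ; map-cong; map-cong-local; filter-accept; filter-reject)
open import Data.List.Relation.Binary.Permutation.Propositional using (_↭_; ↭-refl; ↭-sym; ↭-trans; prep)
open import Data.List.Relation.Binary.Permutation.Propositional.Properties
  using (↭-length; ↭-empty-inv; filter-↭; ∷↭∷ʳ)
  renaming (map⁺ to ↭-map⁺)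
open import Data.List.Relation.Unary.All as All using (All; []; _∷_)
open import Data.List.Relation.Unary.All.Properties using (++⁺; ++⁻; ++⁻ʳ; ∷ʳ⁺; ∷ʳ⁻)
open import Data.List.Relation.Unary.AllPairs using (AllPairs; []; _∷_)
open import Data.List.Relation.Unary.Linked using (Linked; []; [-]; _∷_)
open import Data.List.Relation.Unary.Linked.Properties using (Linked⇒AllPairs)
open import Function using (_∘_)
open import Data.Product using (Σ-syntax; _×_; _,_; proj₁; proj₂)
open import Data.Sum using (_⊎_; inj₁; inj₂)
import Data.Sum as Sum
open import Relation.Nullary using (¬_; Dec; yes; no; contradiction)
open import Relation.Binary.PropositionalEquality
  using (_≡_; _≢_; refl; sym; trans; cong; cong₂; subst; subst₂; module ≡-Reasoning)
open import Data.Nat.Tactic.RingSolver using (solve-∀)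

open import Defs

majStep : ℕ → ℕ → ℕ → ℕ × ℕ
majStep b zero    x = x , 1
majStep b (suc k) x with x ≟ b
... | yes _ = b , suc (suc k)
... | no  _ = b , k

majRun-∷ : ∀ b k x xs → let (b′ , k′) = majStep b k x in majRun b k (x ∷ xs) ≡ b′ ∷ majRun b′ k′ xs
majRun-∷ b zero    x xs = refl
majRun-∷ b (suc k) x xs with x ≟ b
... | yes _ = refl
... | no  _ = refl

majRun-length : ∀ b k xs → length (majRun b k xs) ≡ length xs
majRun-length b k []       = refl
majRun-length b k (x ∷ xs) rewrite majRun-∷ b k x xs = cong suc (majRun-length _ _ xs)

majRun-fresh : ∀ b xs → majRun b 0 xs ≡ majBuffers xs
majRun-fresh b []      = refl
majRun-fresh b (x ∷ xs) = refl

majBuffers-pair : ∀ {l r} xs → r ≢ l → majBuffers (l ∷ r ∷ xs) ≡ l ∷ l ∷ majBuffers xs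
majBuffers-pair {l} {r} xs r≢l with r ≟ l
... | yes r≡l = contradiction r≡l r≢l
... | no  _   = cong (λ ys → l ∷ l ∷ ys) (majRun-fresh l xs)

majRun-All : ∀ {P : ℕ → Set} b k {xs} → P b → All P xs → All P (majRun b k xs)
majRun-All b k       _  []         = []
majRun-All b zero    _  (px ∷ pxs) = px ∷ majRun-All _ 1 px pxs
majRun-All b (suc k) {x ∷ _} pb (_ ∷ pxs) with x ≟ b
... | yes _ = pb ∷ majRun-All b (suc (suc k)) pb pxs
... | no  _ = pb ∷ majRun-All b k pb pxs

majBuffers-All : ∀ {P : ℕ → Set} {xs} → All P xs → All P (majBuffers xs)
majBuffers-All []         = []
majBuffers-All (px ∷ pxs) = px ∷ majRun-All _ 1 px pxs

module Weighted (w : ℕ → ℕ) where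

  -- Only here is _+_ addition on ℕ; at top level it is the rational addition of the theorem.
  open import Data.Nat using (_+_)

  weight : List ℕ → ℕ
  weight X = sum (map w X)

  Heavy : ℕ → ℕ → Set
  Heavy θ a = θ ≤ w a

  Light : ℕ → ℕ → Set
  Light θ a = ¬ Heavy θ a

  isHeavy : ℕ → ℕ → ℕ
  isHeavy θ a with θ ≤? w a
  ... | yes _ = 1
  ... | no  _ = 0

  heavies : ℕ → List ℕ → ℕ
  heavies θ X = sum (map (isHeavy θ) X)

  Sorted : List ℕ → Set
  Sorted = AllPairs (λ a b → w a ≤ w b)

  heavies-++ : ∀ θ X Y → heavies θ (X ++ Y) ≡ heavies θ X + heavies θ Y
  heavies-++ θ X Y = trans (cong sum (map-++ (isHeavy θ) X Y)) (sum-++ (map (isHeavy θ) X) _)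

  heavies-↭ : ∀ θ {X Y} → X ↭ Y → heavies θ X ≡ heavies θ Y
  heavies-↭ θ X↭Y = sum-↭ (↭-map⁺ (isHeavy θ) X↭Y)

  heavies-allHeavy : ∀ {θ X} → All (Heavy θ) X → heavies θ X ≡ length X
  heavies-allHeavy [] = refl
  heavies-allHeavy {θ} {x ∷ _} (h ∷ hs) with θ ≤? w x
  ... | yes _ = cong suc (heavies-allHeavy hs)
  ... | no l  = contradiction h l

  heavies-allLight : ∀ {θ X} → All (Light θ) X → heavies θ X ≡ 0
  heavies-allLight [] = refl
  heavies-allLight {θ} {x ∷ _} (l ∷ ls) with θ ≤? w x
  ... | yes h = contradiction h l
  ... | no _  = heavies-allLight ls

  sorted-light⊎heavy : ∀ θ A {B} → Sorted (A ++ B) → All (Light θ) A ⊎ All (Heavy θ) B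
  sorted-light⊎heavy θ []      _          = inj₁ []
  sorted-light⊎heavy θ (a ∷ A) (a≤ ∷ s) with θ ≤? w a
  ... | yes h = inj₂ (All.map (≤-trans h) (++⁻ʳ A a≤))
  ... | no l  = Sum.map₁ (l ∷_) (sorted-light⊎heavy θ A s)

  sorted-middle : ∀ θ L M R → Sorted (L ++ M ++ R) → length M ≤ 1
                → All (Heavy θ) (M ++ R) ⊎ All (Light θ) (L ++ M)
  sorted-middle θ L [] R s _ with sorted-light⊎heavy θ L s
  ... | inj₁ lightL = inj₂ (++⁺ lightL [])
  ... | inj₂ heavyR = inj₁ heavyR
  sorted-middle θ L (x ∷ []) R s _
    with sorted-light⊎heavy θ (L ++ (x ∷ [])) (subst Sorted (sym (++-assoc L (x ∷ []) R)) s)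
       | sorted-light⊎heavy θ L s
  ... | inj₁ lightLx | _             = inj₂ lightLx
  ... | inj₂ _       | inj₂ heavyxR  = inj₁ heavyxR
  ... | inj₂ heavyR  | inj₁ lightL with θ ≤? w x
  ...   | yes h = inj₁ (h ∷ heavyR)
  ...   | no l  = inj₂ (++⁺ lightL (l ∷ []))
  sorted-middle θ L (_ ∷ _ ∷ _) R _ (s≤s ())

  -- A light buffered item with counter k can still absorb k heavy requests; the potential pays for them.
  potential : ℕ → ℕ → ℕ → ℕ
  potential θ b k with θ ≤? w b
  ... | yes _ = 0
  ... | no  _ = k

  potential-zero : ∀ θ b → potential θ b 0 ≡ 0
  potential-zero θ b with θ ≤? w b
  ... | yes _ = refl
  ... | no  _ = refl

  majStep-potential : ∀ θ b k x → let (b′ , k′) = majStep b k x in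
                      2 * isHeavy θ x + potential θ b′ k′ ≤ isHeavy θ b′ + 1 + potential θ b k
  majStep-potential θ b zero x with θ ≤? w x
  ... | yes _ = s≤s (s≤s z≤n)
  ... | no  _ = s≤s z≤n
  majStep-potential θ b (suc k) x with x ≟ b
  ... | yes refl with θ ≤? w x
  ...   | yes _ = ≤-refl
  ...   | no  _ = ≤-refl
  majStep-potential θ b (suc k) x | no _ with θ ≤? w b | θ ≤? w x
  ...   | yes _ | yes _ = ≤-refl
  ...   | yes _ | no  _ = z≤n
  ...   | no  _ | yes _ = ≤-refl
  ...   | no  _ | no  _ = m≤n+m k 2

  heavies-majRun : ∀ θ b k xs → 2 * heavies θ xs ≤ heavies θ (majRun b k xs) + length xs + potential θ b k
  heavies-majRun θ b k [] = z≤n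
  heavies-majRun θ b k (x ∷ xs) rewrite majRun-∷ b k x xs = +-cancelʳ-≤ p′ _ _ (begin
    2 * (i + H) + p′            ≡⟨ shuffle i H p′ ⟩
    (2 * i + p′) + 2 * H        ≤⟨ +-mono-≤ (majStep-potential θ b k x) (heavies-majRun θ b′ k′ xs) ⟩
    (i′ + 1 + p) + (O + n + p′) ≡⟨ shuffle′ i′ p O n p′ ⟩
    i′ + O + suc n + p + p′     ∎)
    where
    open ≤-Reasoning
    b′ = proj₁ (majStep b k x)
    k′ = proj₂ (majStep b k x)
    i = isHeavy θ x
    H = heavies θ xs
    i′ = isHeavy θ b′
    O = heavies θ (majRun b′ k′ xs)
    n = length xs
    p = potential θ b k
    p′ = potential θ b′ k′
    shuffle : ∀ i H p′ → 2 * (i + H) + p′ ≡ (2 * i + p′) + 2 * H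
    shuffle = solve-∀
    shuffle′ : ∀ i′ p O n p′ → (i′ + 1 + p) + (O + n + p′) ≡ i′ + O + suc n + p + p′
    shuffle′ = solve-∀

  heavies-majBuffers : ∀ θ J → 2 * heavies θ J ≤ heavies θ (majBuffers J) + length J
  heavies-majBuffers θ J = begin
    2 * heavies θ J      ≤⟨ heavies-majRun θ 0 0 J ⟩
    O + potential θ 0 0  ≡⟨ cong (O +_) (potential-zero θ 0) ⟩
    O + 0                ≡⟨ +-identityʳ O ⟩
    O                    ∎
    where
    open ≤-Reasoning
    O = heavies θ (majBuffers J) + length J

  heavies-majBuffers-lower : ∀ θ {J} L M R → J ↭ L ++ M ++ R → Sorted (L ++ M ++ R)
                           → length L ≡ length R → length M ≤ 1
                           → 2 * heavies θ L + heavies θ M ≤ heavies θ (majBuffers J)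
  heavies-majBuffers-lower θ {J} L M R J↭D sorted |L|≡|R| |M|≤1
    with sorted-middle θ L M R sorted |M|≤1
  ... | inj₂ lightLM with lightL , lightM ← ++⁻ L lightLM
    rewrite heavies-allLight lightL | heavies-allLight lightM = z≤n
  ... | inj₁ heavyMR rewrite heavies-allHeavy (proj₁ (++⁻ M heavyMR)) =
    +-cancelʳ-≤ (μ + 2 * ρ) _ _ (begin
      2 * h + μ + (μ + 2 * ρ) ≡⟨ shuffle h μ ρ ⟩
      2 * (h + (μ + ρ))       ≡⟨ cong (2 *_) heavies-J ⟨
      2 * heavies θ J         ≤⟨ heavies-majBuffers θ J ⟩
      O + length J            ≡⟨ cong (O +_) length-J ⟩
      O + (ρ + (μ + ρ))       ≡⟨ shuffle′ O μ ρ ⟩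
      O + (μ + 2 * ρ)         ∎)
    where
    open ≤-Reasoning
    h = heavies θ L
    μ = length M
    ρ = length R
    O = heavies θ (majBuffers J)
    heavies-J : heavies θ J ≡ h + (μ + ρ)
    heavies-J = begin-equality
      heavies θ J             ≡⟨ heavies-↭ θ J↭D ⟩
      heavies θ (L ++ M ++ R) ≡⟨ heavies-++ θ L (M ++ R) ⟩
      h + heavies θ (M ++ R)  ≡⟨ cong (h +_) (heavies-allHeavy heavyMR) ⟩
      h + length (M ++ R)     ≡⟨ cong (h +_) (length-++ M) ⟩
      h + (μ + ρ)             ∎
    length-J : length J ≡ ρ + (μ + ρ)
    length-J = begin-equality
      length J                   ≡⟨ ↭-length J↭D ⟩
      length (L ++ M ++ R)       ≡⟨ length-++ L ⟩
      length L + length (M ++ R) ≡⟨ cong₂ _+_ |L|≡|R| (length-++ M) ⟩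
      ρ + (μ + ρ)                ∎
    shuffle : ∀ h μ ρ → 2 * h + μ + (μ + 2 * ρ) ≡ 2 * (h + (μ + ρ))
    shuffle = solve-∀
    shuffle′ : ∀ O μ ρ → O + (ρ + (μ + ρ)) ≡ O + (μ + 2 * ρ)
    shuffle′ = solve-∀

  -- Layer cake: w x ⊓ K is the number of thresholds θ ∈ [1, K] with θ ≤ w x.
  truncWeight : ℕ → List ℕ → ℕ
  truncWeight K X = sum (map (λ x → w x ⊓ K) X)

  ⊓-suc-layer : ∀ K a → w a ⊓ suc K ≡ w a ⊓ K + isHeavy (suc K) a
  ⊓-suc-layer K a with suc K ≤? w a
  ... | yes K<w rewrite m≥n⇒m⊓n≡n K<w | m≥n⇒m⊓n≡n (≤-trans (n≤1+n K) K<w) = +-comm 1 K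
  ... | no  K≮w
    rewrite m≤n⇒m⊓n≡m (≤-pred (≰⇒> K≮w)) | m≤n⇒m⊓n≡m (m≤n⇒m≤1+n (≤-pred (≰⇒> K≮w))) = sym (+-identityʳ (w a))

  truncWeight-suc : ∀ K X → truncWeight (suc K) X ≡ truncWeight K X + heavies (suc K) X
  truncWeight-suc K []      = refl
  truncWeight-suc K (x ∷ X) rewrite ⊓-suc-layer K x | truncWeight-suc K X =
    interchange (w x ⊓ K) (isHeavy (suc K) x) (truncWeight K X) (heavies (suc K) X)
    where
    interchange : ∀ a b c d → a + b + (c + d) ≡ a + c + (b + d)
    interchange = solve-∀

  truncWeight-zero : ∀ X → truncWeight 0 X ≡ 0
  truncWeight-zero []      = refl
  truncWeight-zero (x ∷ X) rewrite ⊓-zeroʳ (w x) = truncWeight-zero X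

  truncWeight-mono : ∀ A B → (∀ θ → heavies θ A ≤ heavies θ B) → ∀ K → truncWeight K A ≤ truncWeight K B
  truncWeight-mono A B _ zero rewrite truncWeight-zero A | truncWeight-zero B = z≤n
  truncWeight-mono A B layers (suc K) rewrite truncWeight-suc K A | truncWeight-suc K B =
    +-mono-≤ (truncWeight-mono A B layers K) (layers (suc K))

  truncWeight-weight : ∀ {K X} → All (λ x → w x ≤ K) X → truncWeight K X ≡ weight X
  truncWeight-weight bounded = cong sum (map-cong-local (All.map m≤n⇒m⊓n≡m bounded))

  w≤weight : ∀ X → All (λ x → w x ≤ weight X) X
  w≤weight []      = []
  w≤weight (x ∷ X) = m≤m+n (w x) (weight X) ∷ All.map (λ le → ≤-trans le (m≤n+m _ (w x))) (w≤weight X)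

  weight-mono-layers : ∀ A B → (∀ θ → heavies θ A ≤ heavies θ B) → weight A ≤ weight B
  weight-mono-layers A B layers = begin
    weight A        ≡⟨ truncWeight-weight (All.map (λ le → ≤-trans le (m≤m⊔n _ _)) (w≤weight A)) ⟨
    truncWeight K A ≤⟨ truncWeight-mono A B layers K ⟩
    truncWeight K B ≡⟨ truncWeight-weight (All.map (λ le → ≤-trans le (m≤n⊔m _ _)) (w≤weight B)) ⟩
    weight B        ∎
    where
    open ≤-Reasoning
    K = weight A ⊔ weight B

  weight-++ : ∀ X Y → weight (X ++ Y) ≡ weight X + weight Y
  weight-++ X Y = trans (cong sum (map-++ w X Y)) (sum-++ (map w X) _)

  ++-double : ∀ {A : Set} (f : List A → ℕ) → (∀ X Y → f (X ++ Y) ≡ f X + f Y)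
            → ∀ L M → f (L ++ L ++ M) ≡ 2 * f L + f M
  ++-double f f-++ L M = trans (f-++ L (L ++ M)) (trans (cong (f L +_) (f-++ L M)) (regroup (f L) (f M)))
    where
    regroup : ∀ a b → a + (a + b) ≡ 2 * a + b
    regroup = solve-∀

  weight-majBuffers-lower : ∀ {J} L M R → J ↭ L ++ M ++ R → Sorted (L ++ M ++ R)
                          → length L ≡ length R → length M ≤ 1
                          → 2 * weight L + weight M ≤ weight (majBuffers J)
  weight-majBuffers-lower {J} L M R J↭D sorted |L|≡|R| |M|≤1 =
    subst (_≤ weight (majBuffers J)) (++-double weight weight-++ L M)
      (weight-mono-layers (L ++ L ++ M) (majBuffers J) λ θ →
        subst (_≤ heavies θ (majBuffers J)) (sym (++-double (heavies θ) (heavies-++ θ) L M))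
          (heavies-majBuffers-lower θ L M R J↭D sorted |L|≡|R| |M|≤1))

  weight-const : ∀ {v X} → All (λ x → w x ≡ v) X → weight X ≡ v * length X
  weight-const {v} []          = sym (*-zeroʳ v)
  weight-const {v} (wx≡v ∷ eqs) = trans (cong₂ _+_ wx≡v (weight-const eqs)) (sym (*-suc v _))

  majBuffers-constant : ∀ {v} L M R → All (λ y → w y ≡ v) (L ++ M ++ R) → length L ≡ length R
                      → weight (majBuffers (L ++ M ++ R)) ≡ 2 * weight L + weight M
  majBuffers-constant {v} L M R all≡v |L|≡|R| = begin
    weight (majBuffers D)        ≡⟨ weight-const (majBuffers-All all≡v) ⟩
    v * length (majBuffers D)    ≡⟨ cong (v *_) (majRun-length 0 0 D) ⟩
    v * length D                 ≡⟨ cong (v *_) length-D ⟩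
    v * length (L ++ L ++ M)     ≡⟨ weight-const (++⁺ L≡v (++⁺ L≡v M≡v)) ⟨
    weight (L ++ L ++ M)         ≡⟨ ++-double weight weight-++ L M ⟩
    2 * weight L + weight M      ∎
    where
    open ≡-Reasoning
    D = L ++ M ++ R
    L≡v = proj₁ (++⁻ L all≡v)
    M≡v = proj₁ (++⁻ M (proj₂ (++⁻ L all≡v)))
    length-D : length D ≡ length (L ++ L ++ M)
    length-D = begin
      length (L ++ M ++ R)             ≡⟨ length-++ L ⟩
      length L + length (M ++ R)       ≡⟨ cong (length L +_) (length-++ M) ⟩
      length L + (length M + length R) ≡⟨ cong (λ ρ → length L + (length M + ρ)) |L|≡|R| ⟨
      length L + (length M + length L) ≡⟨ cong (length L +_) (+-comm (length M) (length L)) ⟩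
      length L + (length L + length M) ≡⟨ cong (length L +_) (length-++ L) ⟨
      length L + length (L ++ M)       ≡⟨ length-++ L ⟨
      length (L ++ L ++ M)             ∎

  sorted-∷ʳ⁻ : ∀ X {r} → Sorted (X ∷ʳ r) → Sorted X × All (λ y → w y ≤ w r) X
  sorted-∷ʳ⁻ []      _          = [] , []
  sorted-∷ʳ⁻ (x ∷ X) (x≤ ∷ s) with ∷ʳ⁻ x≤ | sorted-∷ʳ⁻ X s
  ... | x≤X , x≤r | sortedX , X≤r = (x≤X ∷ sortedX) , (x≤r ∷ X≤r)

  majBuffers-upper : ∀ L M R → Sorted (L ++ M ++ R) → length L ≡ length R → length M ≤ 1
                   → Σ[ J ∈ List ℕ ] J ↭ L ++ M ++ R × weight (majBuffers J) ≤ 2 * weight L + weight M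
  majBuffers-upper []      []          []      _ _ _        = [] , ↭-refl , z≤n
  majBuffers-upper []      (x ∷ [])    []      _ _ _        = x ∷ [] , ↭-refl , ≤-refl
  majBuffers-upper []      (_ ∷ _ ∷ _) []      _ _ (s≤s ())
  majBuffers-upper []      _           (_ ∷ _) _ () _
  majBuffers-upper (l ∷ L) M R (l≤ ∷ sortedTail) |L|≡|R| |M|≤1 with initLast R
  ... | []      = contradiction |L|≡|R| λ ()
  ... | R ∷ʳ′ r = pair-or-constant (w r ≤? w l)
    where
    X = L ++ M ++ R
    eq : L ++ M ++ R ∷ʳ r ≡ X ∷ʳ r
    eq = sym (trans (++-assoc L (M ++ R) (r ∷ [])) (cong (L ++_) (++-assoc M R (r ∷ []))))
    X≤r : All (λ y → w y ≤ w r) X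
    X≤r = proj₂ (sorted-∷ʳ⁻ X (subst Sorted eq sortedTail))
    pair-or-constant : Dec (w r ≤ w l) → Σ[ J ∈ List ℕ ] J ↭ l ∷ L ++ M ++ R ∷ʳ r
                                         × weight (majBuffers J) ≤ 2 * weight (l ∷ L) + weight M
    pair-or-constant (yes r≤l) =
      l ∷ L ++ M ++ R ∷ʳ r , ↭-refl , ≤-reflexive (majBuffers-constant (l ∷ L) M (R ∷ʳ r) all≡l |L|≡|R|)
      where
      all≡l : All (λ y → w y ≡ w l) (l ∷ L ++ M ++ R ∷ʳ r)
      all≡l = refl ∷ subst (All _) (sym eq)
        (All.zipWith (λ (l≤y , y≤r) → ≤-antisym (≤-trans y≤r r≤l) l≤y)
                     (subst (All _) eq l≤ , ∷ʳ⁺ X≤r ≤-refl))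
    pair-or-constant (no r≰l) =
      let J′ , J′↭X , J′-bound = majBuffers-upper L M R (proj₁ (sorted-∷ʳ⁻ X (subst Sorted eq sortedTail)))
                                                   |L′|≡|R′| |M|≤1
      in l ∷ r ∷ J′
       , prep l (↭-trans (prep r J′↭X) (subst (r ∷ X ↭_) (sym eq) (∷↭∷ʳ r X)))
       , (begin
           weight (majBuffers (l ∷ r ∷ J′))        ≡⟨ cong weight (majBuffers-pair J′ r≢l) ⟩
           w l + (w l + weight (majBuffers J′))    ≤⟨ +-monoʳ-≤ (w l) (+-monoʳ-≤ (w l) J′-bound) ⟩
           w l + (w l + (2 * weight L + weight M)) ≡⟨ regroup (w l) (weight L) (weight M) ⟩
           2 * weight (l ∷ L) + weight M           ∎)
      where
      open ≤-Reasoning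
      r≢l : r ≢ l
      r≢l r≡l = r≰l (≤-reflexive (cong w r≡l))
      |L′|≡|R′| : length L ≡ length R
      |L′|≡|R′| = suc-injective (trans |L|≡|R| (trans (length-++ R) (+-comm (length R) 1)))
      regroup : ∀ a b c → a + (a + (2 * b + c)) ≡ 2 * (a + b) + c
      regroup = solve-∀

  IsMinBufferWeight : List ℕ → ℕ → Set
  IsMinBufferWeight D v = ((J : List ℕ) → J ↭ D → v ≤ weight (majBuffers J))
                        × Σ[ J ∈ List ℕ ] J ↭ D × weight (majBuffers J) ≡ v

  sorted-isMinBufferWeight : ∀ L M R → Sorted (L ++ M ++ R) → length L ≡ length R → length M ≤ 1
                  → IsMinBufferWeight (L ++ M ++ R) (2 * weight L + weight M)
  sorted-isMinBufferWeight L M R sorted |L|≡|R| |M|≤1 =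
      (λ J J↭D → lower J↭D)
    , (let J , J↭D , upper = majBuffers-upper L M R sorted |L|≡|R| |M|≤1
       in J , J↭D , ≤-antisym upper (lower J↭D))
    where
    lower : ∀ {J} → J ↭ L ++ M ++ R → 2 * weight L + weight M ≤ weight (majBuffers J)
    lower J↭D = weight-majBuffers-lower L M R J↭D sorted |L|≡|R| |M|≤1

open import Data.Rational using (ℚ; 0ℚ; _+_; _/_; toℚᵘ)
import Data.Rational as ℚ
import Data.Rational.Properties as ℚ
import Data.Rational.Unnormalised as ℚᵘ
import Data.Rational.Unnormalised.Properties as ℚᵘ
import Data.Integer as ℤ
import Data.Integer.Properties as ℤ
import Data.Nat as ℕ

count≡length-filter : ∀ a X → count a X ≡ length (filter (a ≟_) X)
count≡length-filter a []      = refl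
count≡length-filter a (x ∷ X) with a ≟ x
... | yes a≡x rewrite filter-accept (a ≟_) {xs = X} a≡x = cong suc (count≡length-filter a X)
... | no  a≢x rewrite filter-reject (a ≟_) {xs = X} a≢x = count≡length-filter a X

count-↭ : ∀ a {X Y} → X ↭ Y → count a X ≡ count a Y
count-↭ a {X} {Y} X↭Y = begin
  count a X                  ≡⟨ count≡length-filter a X ⟩
  length (filter (a ≟_) X)   ≡⟨ ↭-length (filter-↭ (a ≟_) X↭Y) ⟩
  length (filter (a ≟_) Y)   ≡⟨ count≡length-filter a Y ⟨
  count a Y                  ∎
  where open ≡-Reasoning

freq-↭ : ∀ {J I} → J ↭ I → ∀ a → freq J a ≡ freq I a
freq-↭ {[]}    {[]}    _   a = refl
freq-↭ {[]}    {_ ∷ _} J↭I a with () ← ↭-length J↭I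
freq-↭ {_ ∷ _} {[]}    J↭I a with () ← ↭-length J↭I
freq-↭ {_ ∷ J} {_ ∷ I} J↭I a =
  cong₂ (λ c n → ℤ.+ c / suc n) (count-↭ a J↭I) (suc-injective (↭-length J↭I))

module Scale (d : ℕ) where

  scale : ℕ → ℚ
  scale a = ℤ.+ a / suc d

  scaleᵘ : ℕ → ℚᵘ.ℚᵘ
  scaleᵘ a = ℚᵘ.mkℚᵘ (ℤ.+ a) d

  toℚᵘ-scale : ∀ a → toℚᵘ (scale a) ℚᵘ.≃ scaleᵘ a
  toℚᵘ-scale a = ℚ.toℚᵘ-fromℚᵘ (scaleᵘ a)

  scale-0 : scale 0 ≡ 0ℚ
  scale-0 = ℚ.0/n≡0 (suc d)

  scale-+ : ∀ a b → scale a + scale b ≡ scale (a ℕ.+ b)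
  scale-+ a b = ℚ.toℚᵘ-injective (begin
    toℚᵘ (scale a + scale b)            ≈⟨ ℚ.toℚᵘ-homo-+ (scale a) (scale b) ⟩
    toℚᵘ (scale a) ℚᵘ.+ toℚᵘ (scale b)  ≈⟨ ℚᵘ.+-cong (toℚᵘ-scale a) (toℚᵘ-scale b) ⟩
    scaleᵘ a ℚᵘ.+ scaleᵘ b              ≈⟨ ℚᵘ.*≡* numerators ⟩
    scaleᵘ (a ℕ.+ b)                    ≈⟨ toℚᵘ-scale (a ℕ.+ b) ⟨
    toℚᵘ (scale (a ℕ.+ b))              ∎)
    where
    open ℚᵘ.≃-Reasoning
    open import Data.Integer.Tactic.RingSolver using () renaming (solve-∀ to solveℤ-∀)
    n = ℤ.+ suc d
    numerators : (ℤ.+ a ℤ.* n ℤ.+ ℤ.+ b ℤ.* n) ℤ.* n ≡ ℤ.+ (a ℕ.+ b) ℤ.* (n ℤ.* n)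
    numerators = trans (distrib (ℤ.+ a) (ℤ.+ b) n) (cong (ℤ._* (n ℤ.* n)) (sym (ℤ.pos-+ a b)))
      where
      distrib : ∀ x y z → (x ℤ.* z ℤ.+ y ℤ.* z) ℤ.* z ≡ (x ℤ.+ y) ℤ.* (z ℤ.* z)
      distrib = solveℤ-∀

  scaleᵘ-mono : ∀ {a b} → a ≤ b → scaleᵘ a ℚᵘ.≤ scaleᵘ b
  scaleᵘ-mono {a} {b} a≤b =
    ℚᵘ.*≤* (subst₂ ℤ._≤_ (ℤ.pos-* a (suc d)) (ℤ.pos-* b (suc d)) (ℤ.+≤+ (*-monoˡ-≤ (suc d) a≤b)))

  scaleᵘ-cancel : ∀ {a b} → scaleᵘ a ℚᵘ.≤ scaleᵘ b → a ≤ b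
  scaleᵘ-cancel {a} {b} (ℚᵘ.*≤* le) =
    *-cancelʳ-≤ a b (suc d)
      (ℤ.drop‿+≤+ (subst₂ ℤ._≤_ (sym (ℤ.pos-* a (suc d))) (sym (ℤ.pos-* b (suc d))) le))

  scale-mono : ∀ {a b} → a ≤ b → scale a ℚ.≤ scale b
  scale-mono {a} {b} a≤b = ℚ.toℚᵘ-cancel-≤
    (ℚᵘ.≤-respˡ-≃ (ℚᵘ.≃-sym (toℚᵘ-scale a))
      (ℚᵘ.≤-respʳ-≃ (ℚᵘ.≃-sym (toℚᵘ-scale b)) (scaleᵘ-mono a≤b)))

  scale-cancel : ∀ {a b} → scale a ℚ.≤ scale b → a ≤ b
  scale-cancel {a} {b} le =
    scaleᵘ-cancel (ℚᵘ.≤-respˡ-≃ (toℚᵘ-scale a) (ℚᵘ.≤-respʳ-≃ (toℚᵘ-scale b) (ℚ.toℚᵘ-mono-≤ le)))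

freqSum : List ℕ → List ℕ → ℚ
freqSum I X = sumℚ (map (freq I) X)

module Frequencies (i : ℕ) (is : List ℕ) where

  I : List ℕ
  I = i ∷ is

  open Weighted (λ a → count a I)
  open Scale (length is)

  -- freq I x is definitionally scale (count x I).
  freqSum-scale : ∀ X → freqSum I X ≡ scale (weight X)
  freqSum-scale []      = sym scale-0
  freqSum-scale (x ∷ X) = trans (cong (freq I x +_) (freqSum-scale X)) (scale-+ (count x I) (weight X))

  Maj-scale : ∀ {J} → J ↭ I → Maj J ≡ scale (weight (majBuffers J))
  Maj-scale {J} J↭I = trans (cong sumℚ (map-cong (freq-↭ J↭I) (majBuffers J))) (freqSum-scale (majBuffers J))

  sortedByFreq⇒sorted : ∀ {D} → SortedByFreq I D → Sorted D
  sortedByFreq⇒sorted = Linked⇒AllPairs ≤-trans ∘ linked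
    where
    linked : ∀ {D} → SortedByFreq I D → Linked (λ a b → count a I ≤ count b I) D
    linked []        = []
    linked [ _ ]     = [-]
    linked (x≤y ∷ s) = scale-cancel x≤y ∷ linked s

  isMajW-scale : ∀ {D v} → D ↭ I → IsMinBufferWeight D v → IsMajW I (scale v)
  isMajW-scale {D} {v} D↭I (lower , J , J↭D , J-min) =
      (λ J′ J′↭I → subst (scale v ℚ.≤_) (sym (Maj-scale J′↭I))
                          (scale-mono (lower J′ (↭-trans J′↭I (↭-sym D↭I)))))
    , J , ↭-trans J↭D D↭I , trans (Maj-scale (↭-trans J↭D D↭I)) (cong scale J-min)

  isMajW-sorted : ∀ L M R → L ++ M ++ R ↭ I → SortedByFreq I (L ++ M ++ R)
                → length L ≡ length R → length M ≤ 1
                → IsMajW I (freqSum I L + freqSum I L + freqSum I M)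
  isMajW-sorted L M R D↭I sorted |L|≡|R| |M|≤1 =
    subst (IsMajW I) value
      (isMajW-scale D↭I (sorted-isMinBufferWeight L M R (sortedByFreq⇒sorted sorted) |L|≡|R| |M|≤1))
    where
    open ≡-Reasoning
    wL = weight L
    wM = weight M
    value : scale (2 * wL ℕ.+ wM) ≡ freqSum I L + freqSum I L + freqSum I M
    value = begin
      scale (2 * wL ℕ.+ wM)                ≡⟨ cong (λ x → scale (wL ℕ.+ x ℕ.+ wM)) (+-identityʳ wL) ⟩
      scale (wL ℕ.+ wL ℕ.+ wM)             ≡⟨ scale-+ (wL ℕ.+ wL) wM ⟨
      scale (wL ℕ.+ wL) + scale wM         ≡⟨ cong (_+ scale wM) (scale-+ wL wL) ⟨
      scale wL + scale wL + scale wM       ≡⟨ cong₂ (λ x y → x + x + y) (freqSum-scale L) (freqSum-scale M) ⟨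
      freqSum I L + freqSum I L + freqSum I M ∎

length-balanced : ∀ {k} (L M R : List ℕ) → length L ≡ k → length (L ++ M ++ R) ≡ length M ℕ.+ 2 * k
                → length L ≡ length R
length-balanced L M R refl len = +-cancelˡ-≡ (length L) _ _ (+-cancelˡ-≡ (length M) _ _ (begin
  length M ℕ.+ (length L ℕ.+ length L) ≡⟨ cong (λ x → length M ℕ.+ (length L ℕ.+ x)) (+-identityʳ (length L)) ⟨
  length M ℕ.+ 2 * length L            ≡⟨ len ⟨
  length (L ++ M ++ R)                 ≡⟨ length-++ L ⟩
  length L ℕ.+ length (M ++ R)         ≡⟨ cong (length L ℕ.+_) (length-++ M) ⟩
  length L ℕ.+ (length M ℕ.+ length R) ≡⟨ swap-front (length L) (length M) (length R) ⟩
  length M ℕ.+ (length L ℕ.+ length R) ∎))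
  where
  open ≡-Reasoning
  swap-front : ∀ a b c → a ℕ.+ (b ℕ.+ c) ≡ b ℕ.+ (a ℕ.+ c)
  swap-front = solve-∀

isMajW-[] : IsMajW [] 0ℚ
isMajW-[] = (λ J J↭[] → subst (λ J → 0ℚ ℚ.≤ Maj J) (sym (↭-empty-inv J↭[])) ℚ.≤-refl) , [] , ↭-refl , refl

lemma1 : (I D : List ℕ) → IsD I D → (k : ℕ)
    → ((length I ≡ suc (2 * k)) → (L R : List ℕ) (x : ℕ) → D ≡ L ++ (x ∷ R) → length L ≡ k
         → IsMajW I ((sumℚ (map (freq I) L) + sumℚ (map (freq I) L)) + freq I x))
    × ((length I ≡ 2 * k) → (L R : List ℕ) → D ≡ L ++ R → length L ≡ k
         → IsMajW I (sumℚ (map (freq I) L) + sumℚ (map (freq I) L)))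
lemma1 [] D (D↭[] , _) k = (λ ()) , λ _ L R D≡L++R _ →
  subst (λ L → IsMajW [] (freqSum [] L + freqSum [] L))
        (sym (++-conicalˡ L R (trans (sym D≡L++R) (↭-empty-inv D↭[]))))
        isMajW-[]
lemma1 (i ∷ is) D (D↭I , sortedD) k =
    (λ |I|≡1+2k L R x D≡L++x∷R |L|≡k →
      subst (λ q → IsMajW I (freqSum I L + freqSum I L + q)) (ℚ.+-identityʳ (freq I x))
        (split L (x ∷ []) R D≡L++x∷R (s≤s z≤n) |L|≡k |I|≡1+2k))
  , (λ |I|≡2k L R D≡L++R |L|≡k →
      subst (IsMajW I) (ℚ.+-identityʳ _) (split L [] R D≡L++R z≤n |L|≡k |I|≡2k))
  where
  open Frequencies i is
  split : ∀ L M R → D ≡ L ++ M ++ R → length M ≤ 1 → length L ≡ k → length I ≡ length M ℕ.+ 2 * k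
        → IsMajW I (freqSum I L + freqSum I L + freqSum I M)
  split L M R refl |M|≤1 |L|≡k |I|≡ =
    isMajW-sorted L M R D↭I sortedD (length-balanced L M R |L|≡k (trans (↭-length D↭I) |I|≡)) |M|≤1
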